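{- Let $G$ be a minimally $2$-connected graph. Then for every $x \in V(G)$ there exist $u, v, w \in V(G)$ such that $v, w \in N_G(u)$, $\deg_G(v) = \deg_G(w) = 2$, and $x \notin \{v, w\}$.
   Context: A graph is chordless if no cycle in it has a chord. A graph is minimally $2$-connected if it is $2$-connected and chordless. $N_G(u)$ denotes the set of neighbours of $u$ and $\deg_G(v) = |N_G(v)|$. Vertices $v,w$ are understood to be distinct. -}

module Defs where

open import Data.Nat using (ℕ; zero; suc; _+_; _∸_; _≤_)
open import Data.Fin using (Fin; toℕ)
open import Data.Fin.Subset using (Subset; ∣_∣)
open import Data.Vec using (tabulate)
open import Data.Bool using (Bool; T)
open import Data.Unit using (⊤)
open import Data.Empty using (⊥)
open import Data.Product using (_×_; Σ; ∃-syntax)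
open import Data.Sum using (_⊎_)
open import Function.Definitions using (Injective)
open import Relation.Binary.PropositionalEquality using (_≡_; _≢_)
open import Relation.Nullary using (¬_)

record Graph : Set where
  field
    n     : ℕ
    adj   : Fin n → Fin n → Bool
    sym   : ∀ u v → adj u v ≡ adj v u
    irrefl : ∀ u → adj u u ≡ Data.Bool.false

open Graph public

Edge : (G : Graph) → Fin (n G) → Fin (n G) → Set
Edge G u v = T (adj G u v)

N : (G : Graph) → Fin (n G) → Subset (n G)
N G u = tabulate (adj G u)

deg : (G : Graph) → Fin (n G) → ℕ
deg G u = ∣ N G u ∣

data Walk (G : Graph) (ok : Fin (n G) → Set) : Fin (n G) → Fin (n G) → Set where
  here : ∀ {u} → ok u → Walk G ok u u
  step : ∀ {u v w} → ok u → Edge G u v → Walk G ok v w → Walk G ok u w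

Connected : Graph → Set
Connected G = ∀ u v → Walk G (λ _ → ⊤) u v

ConnectedWithout : (G : Graph) → Fin (n G) → Set
ConnectedWithout G z = ∀ u v → u ≢ z → v ≢ z → Walk G (λ y → y ≢ z) u v

-- 2-connected: more than 2 vertices, and G - X connected for every |X| < 2.
TwoConnected : Graph → Set
TwoConnected G = 3 ≤ n G × Connected G × (∀ z → ConnectedWithout G z)

Next : {k : ℕ} → Fin k → Fin k → Set
Next {k} i j = (suc (toℕ i) ≡ toℕ j) ⊎ ((suc (toℕ i) ≡ k) × (toℕ j ≡ 0))

record Cycle (G : Graph) (k : ℕ) : Set where
  field
    len≥3 : 3 ≤ k
    c     : Fin k → Fin (n G)
    inj   : Injective _≡_ _≡_ c
    edges : ∀ i j → Next i j → Edge G (c i) (c j)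

HasChord : (G : Graph) {k : ℕ} → Cycle G k → Set
HasChord G {k} C = ∃[ i ] ∃[ j ] (Edge G (Cycle.c C i) (Cycle.c C j) × i ≢ j × ¬ Next i j × ¬ Next j i)

Chordless : Graph → Set
Chordless G = ∀ k (C : Cycle G k) → ¬ HasChord G C

MinimallyTwoConnected : Graph → Set
MinimallyTwoConnected G = TwoConnected G × Chordless G

module Submission where

-- Take a path P = v₀ v₁ … v_m ending at x and extend it at v₀ as long as possible.
-- Once all neighbours of v₀ lie on P, 2-connectivity gives v₀ a neighbour v_a with a ≥ 2,
-- and v₀ has no further neighbour v_j with j ≥ 2: the nearer of v_a, v_j would give a chord
-- of the cycle closed by the farther one. So N(v₀) = {v₁, v_a}. Rotating P along v₀v_a
-- gives the path v_{a-1} … v₀ v_a … v_m, again ending at x; if it cannot be extended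
-- either, v_{a-1} has degree 2 as well, and u = v_a, v = v₀, w = v_{a-1} work, since
-- x = v_m comes after both on P.

open import Defs hiding (sym)
open import Data.Bool using (T; T?)
open import Data.Bool.Properties using (T-≡)
open import Data.Empty using (⊥)
open import Data.Fin using (Fin; zero; suc; toℕ; fromℕ<; _≟_)
open import Data.Fin.Properties using (toℕ-injective; toℕ<n; toℕ-fromℕ<; any?; injective⇒≤)
open import Data.Fin.Subset using (_∈_; _∪_; ⁅_⁆; ∣_∣)
open import Data.Fin.Subset.Properties using (∣⁅x⁆∣≡1; ∪-identityˡ; ∪-identityʳ; ⊆-antisym; x∈p∪q⁺; x∈p∪q⁻; x∈⁅x⁆; x∈⁅y⁆⇒x≡y)
open import Data.Nat using (ℕ; zero; suc; _≤_; _<_; _∸_; _+_; z≤n; s≤s; s≤s⁻¹; _≤?_)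
open import Data.Nat.Properties using (≤-refl; ≤-trans; 0≢1+n; <⇒≤; <⇒≱; ≰⇒>; m≤n⇒m≤1+n; +-suc; +-identityʳ; n∸n≡0; m∸n≤m; m∸[m∸n]≡n; +-∸-assoc; <-cmp; <-irrefl; suc-injective; anyUpTo?)
open import Data.Product using (_×_; ∃-syntax; _,_)
open import Data.Sum using (_⊎_; inj₁; inj₂; [_,_])
open import Data.Vec.Properties using (lookup∘tabulate; []=⇒lookup; lookup⇒[]=)
open import Function using (_∘_; _⇔_; mk⇔; Equivalence)
open import Relation.Binary using (tri<; tri≈; tri>)
open import Relation.Binary.PropositionalEquality using (_≡_; _≢_; refl; sym; trans; cong; subst)
open import Relation.Nullary using (¬_; Dec; yes; no; ¬?; _×-dec_; contradiction)
open import Relation.Nullary.Decidable using (decidable-stable)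

open Equivalence using (to; from)

∣⁅x⁆∪⁅y⁆∣≡2 : ∀ {k} {x y : Fin k} → x ≢ y → ∣ ⁅ x ⁆ ∪ ⁅ y ⁆ ∣ ≡ 2
∣⁅x⁆∪⁅y⁆∣≡2 {x = zero}  {zero}  x≢y = contradiction refl x≢y
∣⁅x⁆∪⁅y⁆∣≡2 {x = zero}  {suc y} _   = cong suc (trans (cong ∣_∣ (∪-identityˡ ⁅ y ⁆)) (∣⁅x⁆∣≡1 y))
∣⁅x⁆∪⁅y⁆∣≡2 {x = suc x} {zero}  _   = cong suc (trans (cong ∣_∣ (∪-identityʳ ⁅ x ⁆)) (∣⁅x⁆∣≡1 x))
∣⁅x⁆∪⁅y⁆∣≡2 {x = suc x} {suc y} x≢y = ∣⁅x⁆∪⁅y⁆∣≡2 (x≢y ∘ cong suc)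

avoid-two : ∀ {k} → 3 ≤ k → (a b : Fin k) → ∃[ t ] (t ≢ a × t ≢ b)
avoid-two (s≤s (s≤s (s≤s _))) zero          zero          = suc zero , (λ ()) , (λ ())
avoid-two (s≤s (s≤s (s≤s _))) zero          (suc zero)    = suc (suc zero) , (λ ()) , (λ ())
avoid-two (s≤s (s≤s (s≤s _))) zero          (suc (suc _)) = suc zero , (λ ()) , (λ ())
avoid-two (s≤s (s≤s (s≤s _))) (suc zero)    zero          = suc (suc zero) , (λ ()) , (λ ())
avoid-two (s≤s (s≤s (s≤s _))) (suc (suc _)) zero          = suc zero , (λ ()) , (λ ())
avoid-two (s≤s (s≤s (s≤s _))) (suc _)       (suc _)       = zero , (λ ()) , (λ ())

reverseUpTo : ℕ → ℕ → ℕ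
reverseUpTo r i with i ≤? r
... | yes _ = r ∸ i
... | no  _ = i

reverseUpTo-≤ : ∀ {r i} → i ≤ r → reverseUpTo r i ≡ r ∸ i
reverseUpTo-≤ {r} {i} i≤r with i ≤? r
... | yes _   = refl
... | no  i≰r = contradiction i≤r i≰r

reverseUpTo-> : ∀ {r i} → r < i → reverseUpTo r i ≡ i
reverseUpTo-> {r} {i} r<i with i ≤? r
... | yes i≤r = contradiction i≤r (<⇒≱ r<i)
... | no  _   = refl

reverseUpTo-involutive : ∀ r i → reverseUpTo r (reverseUpTo r i) ≡ i
reverseUpTo-involutive r i with i ≤? r
... | yes i≤r = trans (reverseUpTo-≤ (m∸n≤m r i)) (m∸[m∸n]≡n i≤r)
... | no  i≰r = reverseUpTo-> (≰⇒> i≰r)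

reverseUpTo-injective : ∀ r {i j} → reverseUpTo r i ≡ reverseUpTo r j → i ≡ j
reverseUpTo-injective r {i} {j} eq =
  trans (sym (reverseUpTo-involutive r i)) (trans (cong (reverseUpTo r) eq) (reverseUpTo-involutive r j))

reverseUpTo-≤-bound : ∀ {r i m} → r ≤ m → i ≤ m → reverseUpTo r i ≤ m
reverseUpTo-≤-bound {r} {i} r≤m i≤m with i ≤? r
... | yes _ = ≤-trans (m∸n≤m r i) r≤m
... | no  _ = i≤m

module _ (G : Graph) where

  private
    Vertex : Set
    Vertex = Fin (n G)

  Edge-sym : ∀ {u v} → Edge G u v → Edge G v u
  Edge-sym {u} {v} = subst T (Graph.sym G u v)

  Edge⇒≢ : ∀ {u v} → Edge G u v → u ≢ v
  Edge⇒≢ {u} e refl = subst T (irrefl G u) e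

  Edge-cong : ∀ {u u′ v v′} → u ≡ u′ → v ≡ v′ → Edge G u′ v′ → Edge G u v
  Edge-cong refl refl e = e

  Edge? : ∀ u v → Dec (Edge G u v)
  Edge? u v = T? (adj G u v)

  ∈N⇔Edge : ∀ {v y} → y ∈ N G v ⇔ Edge G v y
  ∈N⇔Edge {v} {y} = mk⇔
    (λ y∈N → from T-≡ (trans (sym (lookup∘tabulate (adj G v) y)) ([]=⇒lookup y∈N)))
    (λ e → lookup⇒[]= y _ (trans (lookup∘tabulate (adj G v) y) (to T-≡ e)))

  deg≡2 : ∀ {v b c} → b ≢ c → Edge G v b → Edge G v c →
          (∀ y → Edge G v y → y ≡ b ⊎ y ≡ c) → deg G v ≡ 2
  deg≡2 {v} {b} {c} b≢c eb ec only = trans (cong ∣_∣ N≡⁅b⁆∪⁅c⁆) (∣⁅x⁆∪⁅y⁆∣≡2 b≢c)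
    where
    N≡⁅b⁆∪⁅c⁆ : N G v ≡ ⁅ b ⁆ ∪ ⁅ c ⁆
    N≡⁅b⁆∪⁅c⁆ = ⊆-antisym
      (λ {y} y∈N → x∈p∪q⁺ ([ (λ { refl → inj₁ (x∈⁅x⁆ y) }) , (λ { refl → inj₂ (x∈⁅x⁆ y) }) ]
                              (only y (to ∈N⇔Edge y∈N))))
      (λ y∈⁅b⁆∪⁅c⁆ → from ∈N⇔Edge ([ (λ y∈⁅b⁆ → Edge-cong refl (x∈⁅y⁆⇒x≡y b y∈⁅b⁆) eb)
                                   , (λ y∈⁅c⁆ → Edge-cong refl (x∈⁅y⁆⇒x≡y c y∈⁅c⁆) ec) ]
                                   (x∈p∪q⁻ ⁅ b ⁆ ⁅ c ⁆ y∈⁅b⁆∪⁅c⁆)))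

  Walk⇒first-step : ∀ {ok u t} → u ≢ t → Walk G ok u t → ∃[ w ] (Edge G u w × ok w)
  Walk⇒first-step u≢t (here _)                = contradiction refl u≢t
  Walk⇒first-step _   (step _ e (here ok))     = _ , e , ok
  Walk⇒first-step _   (step _ e (step ok _ _)) = _ , e , ok

  TwoConnected⇒neighbour-avoiding : TwoConnected G → ∀ v z → ∃[ w ] (Edge G v w × w ≢ z)
  TwoConnected⇒neighbour-avoiding (3≤n , connected , connected-without) v z
    with t , t≢v , t≢z ← avoid-two 3≤n v z
    with v ≟ z
  ... | yes refl with w , e , _ ← Walk⇒first-step (t≢v ∘ sym) (connected v t)
                 = w , e , Edge⇒≢ e ∘ sym
  ... | no v≢z = Walk⇒first-step (t≢v ∘ sym) (connected-without z v t v≢z t≢z)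

  -- `vertex` is total on ℕ; only its values at 0, …, m belong to the path.
  record Path (x : Vertex) (m : ℕ) : Set where
    field
      vertex    : ℕ → Vertex
      injective : ∀ {i j} → i ≤ m → j ≤ m → vertex i ≡ vertex j → i ≡ j
      edge      : ∀ {i} → i < m → Edge G (vertex i) (vertex (suc i))
      ends-at   : vertex m ≡ x

    start : Vertex
    start = vertex 0

  open Path

  trivialPath : ∀ x → Path x 0
  trivialPath x = record
    { vertex = λ _ → x ; injective = λ { z≤n z≤n _ → refl } ; edge = λ () ; ends-at = refl }

  Path⇒length<n : ∀ {x m} → Path x m → m < n G
  Path⇒length<n {m = m} P = injective⇒≤ {f = vertex P ∘ toℕ {suc m}}
    (λ {i} {j} eq → toℕ-injective (injective P (s≤s⁻¹ (toℕ<n i)) (s≤s⁻¹ (toℕ<n j)) eq))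

  OnPath : ∀ {x m} → Path x m → Vertex → Set
  OnPath {m = m} P y = ∃[ i ] (i < suc m × vertex P i ≡ y)

  onPath? : ∀ {x m} (P : Path x m) y → Dec (OnPath P y)
  onPath? {m = m} P y = anyUpTo? (λ i → vertex P i ≟ y) (suc m)

  extend : ∀ {x m y} (P : Path x m) → Edge G (start P) y → ¬ OnPath P y → Path x (suc m)
  extend {x} {m} {y} P e off = record
    { vertex = vertex′ ; injective = injective′ ; edge = edge′ ; ends-at = ends-at P }
    where
    vertex′ : ℕ → Vertex
    vertex′ zero    = y
    vertex′ (suc i) = vertex P i
    injective′ : ∀ {i j} → i ≤ suc m → j ≤ suc m → vertex′ i ≡ vertex′ j → i ≡ j
    injective′ {zero}  {zero}  _         _         _  = refl
    injective′ {zero}  {suc j} _         j+1≤m+1   eq = contradiction (j , j+1≤m+1 , sym eq) off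
    injective′ {suc i} {zero}  i+1≤m+1   _         eq = contradiction (i , i+1≤m+1 , eq) off
    injective′ {suc i} {suc j} i+1≤m+1   j+1≤m+1   eq =
      cong suc (injective P (s≤s⁻¹ i+1≤m+1) (s≤s⁻¹ j+1≤m+1) eq)
    edge′ : ∀ {i} → i < suc m → Edge G (vertex′ i) (vertex′ (suc i))
    edge′ {zero}  _       = Edge-sym e
    edge′ {suc i} i+1<m+1 = edge P (s≤s⁻¹ i+1<m+1)

  closingCycle : ∀ {x m a} (P : Path x m) → 2 ≤ a → a ≤ m → Edge G (start P) (vertex P a) → Cycle G (suc a)
  closingCycle {m = m} {a} P 2≤a a≤m e = record
    { len≥3 = s≤s 2≤a
    ; c     = vertex P ∘ toℕ
    ; inj   = λ {i} {j} eq → toℕ-injective (injective P (bound i) (bound j) eq)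
    ; edges = edges }
    where
    bound : (i : Fin (suc a)) → toℕ i ≤ m
    bound i = ≤-trans (s≤s⁻¹ (toℕ<n i)) a≤m
    edges : ∀ i j → Next i j → Edge G (vertex P (toℕ i)) (vertex P (toℕ j))
    edges i j (inj₁ i+1≡j) =
      Edge-cong refl (cong (vertex P) (sym i+1≡j)) (edge P (subst (_≤ m) (sym i+1≡j) (bound j)))
    edges i j (inj₂ (i+1≡a+1 , j≡0)) =
      Edge-cong (cong (vertex P) (suc-injective i+1≡a+1)) (cong (vertex P) j≡0) (Edge-sym e)

  no-short-chord : ∀ {x m a c} → Chordless G → (P : Path x m) → 2 ≤ c → c < a → a ≤ m →
                   Edge G (start P) (vertex P c) → Edge G (start P) (vertex P a) → ⊥
  no-short-chord {a = a} {c} chordless P 2≤c@(s≤s (s≤s _)) c<a a≤m ec ea =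
    chordless (suc a) (closingCycle P 2≤a a≤m ea)
      (zero , C , Edge-cong refl (cong (vertex P) toℕC≡c) ec , 0≢C , ¬0→C , ¬C→0)
    where
    2≤a : 2 ≤ a
    2≤a = ≤-trans 2≤c (<⇒≤ c<a)
    C : Fin (suc a)
    C = fromℕ< (s≤s (<⇒≤ c<a))
    toℕC≡c : toℕ C ≡ c
    toℕC≡c = toℕ-fromℕ< (s≤s (<⇒≤ c<a))
    0≢C : zero ≢ C
    0≢C 0≡C = 0≢1+n (trans (cong toℕ 0≡C) toℕC≡c)
    ¬0→C : ¬ Next zero C
    ¬0→C (inj₁ 1≡C)       = 0≢1+n (suc-injective (trans 1≡C toℕC≡c))
    ¬0→C (inj₂ (1≡a+1 , _)) = <-irrefl (suc-injective 1≡a+1) (≤-trans (s≤s z≤n) 2≤a)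
    ¬C→0 : ¬ Next C zero
    ¬C→0 (inj₁ ())
    ¬C→0 (inj₂ (C+1≡a+1 , _)) = <-irrefl (trans (sym toℕC≡c) (suc-injective C+1≡a+1)) c<a

  Chordless⇒back-neighbour-unique :
    ∀ {x m a b} → Chordless G → (P : Path x m) → 2 ≤ a → 2 ≤ b → a ≤ m → b ≤ m →
    Edge G (start P) (vertex P a) → Edge G (start P) (vertex P b) → a ≡ b
  Chordless⇒back-neighbour-unique {a = a} {b} chordless P 2≤a 2≤b a≤m b≤m ea eb with <-cmp a b
  ... | tri< a<b _ _ = contradiction eb (no-short-chord chordless P 2≤a a<b b≤m ea)
  ... | tri≈ _ a≡b _ = a≡b
  ... | tri> _ _ b<a = contradiction ea (no-short-chord chordless P 2≤b b<a a≤m eb)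

  back-neighbour-index : ∀ {x m j} (P : Path x m) → Edge G (start P) (vertex P j) → j ≡ 1 ⊎ 2 ≤ j
  back-neighbour-index {j = zero}        P e = contradiction refl (Edge⇒≢ e)
  back-neighbour-index {j = suc zero}    P e = inj₁ refl
  back-neighbour-index {j = suc (suc j)} P e = inj₂ (s≤s (s≤s z≤n))

  DegreeTwoStart : ∀ {x m} → Path x m → Set
  DegreeTwoStart {m = m} P = ∃[ a ] (2 ≤ a × a ≤ m × Edge G (start P) (vertex P a) × deg G (start P) ≡ 2)

  stuck⇒DegreeTwoStart : ∀ {x m} → TwoConnected G → Chordless G → (P : Path x m) →
                         (∀ y → Edge G (start P) y → OnPath P y) → DegreeTwoStart P
  stuck⇒DegreeTwoStart {m = m} tc chordless P stuck
    with w , e , w≢v₁ ← TwoConnected⇒neighbour-avoiding tc (start P) (vertex P 1)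
    with a , s≤s a≤m , refl ← stuck w e
    with back-neighbour-index P e
  ... | inj₁ refl = contradiction refl w≢v₁
  ... | inj₂ 2≤a  = a , 2≤a , a≤m , e , deg≡2 v₁≢vₐ (edge P 0<m) e only
    where
    0<m : 0 < m
    0<m = ≤-trans (s≤s z≤n) (≤-trans 2≤a a≤m)
    v₁≢vₐ : vertex P 1 ≢ vertex P a
    v₁≢vₐ eq = <-irrefl (injective P 0<m a≤m eq) 2≤a
    only : ∀ y → Edge G (start P) y → y ≡ vertex P 1 ⊎ y ≡ vertex P a
    only y e′ with j , s≤s j≤m , refl ← stuck y e′ with back-neighbour-index P e′
    ... | inj₁ refl = inj₁ refl
    ... | inj₂ 2≤j  = inj₂ (cong (vertex P) (Chordless⇒back-neighbour-unique chordless P 2≤j 2≤a j≤m a≤m e′ e))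

  extend-or-DegreeTwoStart : ∀ {x m} → TwoConnected G → Chordless G → (P : Path x m) →
                             Path x (suc m) ⊎ DegreeTwoStart P
  extend-or-DegreeTwoStart tc chordless P
    with any? (λ y → Edge? (start P) y ×-dec ¬? (onPath? P y))
  ... | yes (y , e , off) = inj₁ (extend P e off)
  ... | no no-exit        = inj₂ (stuck⇒DegreeTwoStart tc chordless P
          (λ y e → decidable-stable (onPath? P y) (λ off → no-exit (y , e , off))))

  -- Pósa rotation: v_r, …, v₀, v_{r+1}, …, v_m.
  rotate : ∀ {x m} (P : Path x m) r → r < m → Edge G (start P) (vertex P (suc r)) → Path x m
  rotate {x} {m} P r r<m e = record
    { vertex    = vertex P ∘ reverseUpTo r
    ; injective = λ i≤m j≤m eq →
        reverseUpTo-injective r (injective P (reverseUpTo-≤-bound r≤m i≤m) (reverseUpTo-≤-bound r≤m j≤m) eq)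
    ; edge      = edge′
    ; ends-at   = trans (cong (vertex P) (reverseUpTo-> r<m)) (ends-at P) }
    where
    r≤m : r ≤ m
    r≤m = <⇒≤ r<m
    edge′ : ∀ {i} → i < m → Edge G (vertex P (reverseUpTo r i)) (vertex P (reverseUpTo r (suc i)))
    edge′ {i} i<m with <-cmp i r
    ... | tri< i<r _ _ = Edge-cong (cong (vertex P) (trans (reverseUpTo-≤ (<⇒≤ i<r)) (+-∸-assoc 1 i<r)))
                                   (cong (vertex P) (reverseUpTo-≤ i<r))
                                   (Edge-sym (edge P (≤-trans (s≤s (m∸n≤m r (suc i))) r<m)))
    ... | tri≈ _ refl _ = Edge-cong (cong (vertex P) (trans (reverseUpTo-≤ {r} ≤-refl) (n∸n≡0 r)))
                                    (cong (vertex P) (reverseUpTo-> {r} ≤-refl))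
                                    e
    ... | tri> _ _ r<i = Edge-cong (cong (vertex P) (reverseUpTo-> r<i))
                                   (cong (vertex P) (reverseUpTo-> (m≤n⇒m≤1+n r<i)))
                                   (edge P i<m)

  DegreeTwoPairAvoiding : Vertex → Set
  DegreeTwoPairAvoiding x = ∃[ u ] ∃[ v ] ∃[ w ]
    (v ≢ w × Edge G u v × Edge G u w × deg G v ≡ 2 × deg G w ≡ 2 × x ≢ v × x ≢ w)

  rotation⇒DegreeTwoPairAvoiding :
    ∀ {x m r} (P : Path x m) → 0 < r → (r<m : r < m) (e : Edge G (start P) (vertex P (suc r))) →
    deg G (start P) ≡ 2 → deg G (start (rotate P r r<m e)) ≡ 2 → DegreeTwoPairAvoiding x
  rotation⇒DegreeTwoPairAvoiding {x} {r = r} P 0<r r<m e deg₀ degᵣ =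
    vertex P (suc r) , start P , vertex P r , v₀≢vᵣ , Edge-sym e , Edge-sym (edge P r<m) ,
    deg₀ , degᵣ , x≢v₀ , x≢vᵣ
    where
    v₀≢vᵣ : start P ≢ vertex P r
    v₀≢vᵣ eq = <-irrefl (injective P z≤n (<⇒≤ r<m) eq) 0<r
    x≢v₀ : x ≢ start P
    x≢v₀ eq = <-irrefl (sym (injective P ≤-refl z≤n (trans (ends-at P) eq))) (≤-trans 0<r (<⇒≤ r<m))
    x≢vᵣ : x ≢ vertex P r
    x≢vᵣ eq = <-irrefl (sym (injective P ≤-refl (<⇒≤ r<m) (trans (ends-at P) eq))) r<m

  -- Fuel k: a path has fewer than n G edges, so it cannot be extended more than k times.
  Path⇒DegreeTwoPairAvoiding : ∀ {x} → TwoConnected G → Chordless G →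
                               ∀ k {m} → n G ≤ m + k → Path x m → DegreeTwoPairAvoiding x
  Path⇒DegreeTwoPairAvoiding _ _ zero {m} n≤m P =
    contradiction (subst (n G ≤_) (+-identityʳ m) n≤m) (<⇒≱ (Path⇒length<n P))
  Path⇒DegreeTwoPairAvoiding tc chordless (suc k) {m} n≤m+k+1 P
    with extend-or-DegreeTwoStart tc chordless P
  ... | inj₁ P⁺ = Path⇒DegreeTwoPairAvoiding tc chordless k (subst (n G ≤_) (+-suc m k) n≤m+k+1) P⁺
  ... | inj₂ (suc r , s≤s 0<r , r<m , e , deg₀)
    with extend-or-DegreeTwoStart tc chordless (rotate P r r<m e)
  ...   | inj₁ Q⁺ = Path⇒DegreeTwoPairAvoiding tc chordless k (subst (n G ≤_) (+-suc m k) n≤m+k+1) Q⁺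
  ...   | inj₂ (_ , _ , _ , _ , degᵣ) = rotation⇒DegreeTwoPairAvoiding P 0<r r<m e deg₀ degᵣ

mainTheorem4 : (G : Graph) → MinimallyTwoConnected G → (x : Fin (n G)) →
    ∃[ u ] ∃[ v ] ∃[ w ] (v ≢ w × Edge G u v × Edge G u w ×
    deg G v ≡ 2 × deg G w ≡ 2 × x ≢ v × x ≢ w)
mainTheorem4 G (tc , chordless) x =
  Path⇒DegreeTwoPairAvoiding G tc chordless (n G) ≤-refl (trivialPath G x)
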